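{- For every natural number $k\geq 12$, $-\frac{k^2}{16}\leq g(k)\leq -\frac{(k-8)^2}{72}$.
   Context: All graphs are finite, simple and undirected. For a vertex $v$, $E(v)$ denotes the set of edges incident with $v$. For an edge $e=uv$, $N[e]$ denotes the set of edges of $G$ sharing at least one endpoint with $e$ (including $e$ itself). For a graph $G$ with at least one edge, a function $f:E(G)\to\{ -1,1\}$ is a signed edge domination function (SEDF) if $\sum_{e'\in N[e]}f(e')\geq 1$ for every $e\in E(G)$. The signed edge domination number is $\gamma'_s(G)=\min\{\sum_{e\in E(G)}f(e) : f \text{ is an SEDF of } G\}$. For a natural number $k$, $g(k)=\min\{\gamma'_s(G) : G \text{ a graph with } |V(G)|=k \text{ (and at least one edge)}\}$. -}

module Defs where

open import Data.Bool using (Bool; true; false; if_then_else_; _∧_; _∨_)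
open import Data.Nat using (ℕ; zero; suc; _<ᵇ_)
open import Data.Fin using (Fin; toℕ; _≟_)
open import Data.Fin.Base using () renaming (zero to fzero; suc to fsuc)
open import Data.List using (List; []; _∷_; length; concatMap; lookup)
open import Data.List using () renaming (allFin to allFinL)
open import Data.Product using (_×_; _,_; proj₁; proj₂; Σ; ∃)
open import Data.Integer using (ℤ; +_; -[1+_]; _+_; _≤_)
open import Data.Sign using (Sign)
open import Relation.Nullary.Decidable using (⌊_⌋)
open import Relation.Binary.PropositionalEquality using (_≡_)

record Graph (k : ℕ) : Set where
  field
    adj    : Fin k → Fin k → Bool
    sym    : ∀ i j → adj i j ≡ adj j i
    irrefl : ∀ i → adj i i ≡ false
open Graph public

-- The edge set E(G): each edge {i,j} listed exactly once as the pair (i , j) with i < j.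
edges : ∀ {k} → Graph k → List (Fin k × Fin k)
edges {k} G =
  concatMap (λ i → concatMap (λ j →
      if (toℕ i <ᵇ toℕ j) ∧ adj G i j then (i , j) ∷ [] else [])
    (allFinL k)) (allFinL k)

nE : ∀ {k} → Graph k → ℕ
nE G = length (edges G)

Edge : ∀ {k} → Graph k → Set
Edge G = Fin (nE G)

ends : ∀ {k} (G : Graph k) → Edge G → Fin k × Fin k
ends G e = lookup (edges G) e

-- e' ∈ N[e]: e' shares at least one endpoint with e (includes e itself).
shareEnd : ∀ {k} (G : Graph k) → Edge G → Edge G → Bool
shareEnd G e e' with ends G e | ends G e'
... | (a , b) | (c , d) = ⌊ a ≟ c ⌋ ∨ ⌊ a ≟ d ⌋ ∨ ⌊ b ≟ c ⌋ ∨ ⌊ b ≟ d ⌋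

sumFin : (n : ℕ) → (Fin n → ℤ) → ℤ
sumFin zero    f = + 0
sumFin (suc n) f = f fzero + sumFin n (λ i → f (fsuc i))

val : Sign → ℤ
val Sign.- = -[1+ 0 ]
val Sign.+ = + 1

Labelling : ∀ {k} → Graph k → Set
Labelling G = Edge G → Sign

closedSum : ∀ {k} (G : Graph k) → Labelling G → Edge G → ℤ
closedSum G f e = sumFin (nE G) (λ e' → if shareEnd G e e' then val (f e') else + 0)

IsSEDF : ∀ {k} (G : Graph k) → Labelling G → Set
IsSEDF G f = ∀ (e : Edge G) → + 1 ≤ closedSum G f e

weight : ∀ {k} (G : Graph k) → Labelling G → ℤ
weight G f = sumFin (nE G) (λ e → val (f e))

-- G has at least one edge.
HasEdge : ∀ {k} → Graph k → Set
HasEdge G = Edge G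

-- g(k) = min { γ'_s(G) : |V(G)| = k, E(G) ≠ ∅ }, where
-- γ'_s(G) = min { weight f : f SEDF of G }.  Hence g(k) = min of weight G f over all
-- (G , f) with G on k vertices having an edge and f an SEDF of G.
-- Lower bound  x ≤ g(k)  : every such (G , f) has weight ≥ x.
-- Upper bound  g(k) ≤ x  : some such (G , f) has weight ≤ x.
-- Bounds are stated multiplied through by positive denominators (scaled ℤ inequalities).
gAtLeastScaled : (k : ℕ) (d : ℕ) (x : ℤ) → Set   -- x / d ≤ g(k), d > 0
gAtLeastScaled k d x = ∀ (G : Graph k) → HasEdge G → (f : Labelling G) → IsSEDF G f →
                       x ≤ (+ d) Data.Integer.* weight G f

gAtMostScaled : (k : ℕ) (d : ℕ) (x : ℤ) → Set    -- g(k) ≤ x / d, d > 0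
gAtMostScaled k d x = Σ (Graph k) λ G → HasEdge G × Σ (Labelling G) λ f → IsSEDF G f ×
                      ((+ d) Data.Integer.* weight G f ≤ x)

-- Lower bound.  For an SEDF f with P positive and M negative edges, let d⁺, d⁻ be the positive
-- and negative degrees and σ = d⁺ − d⁻.  Every closed edge neighbourhood sum is
-- f[N[ab]] = σ(a) + σ(b) − f(ab), so σ(a) + σ(b) ≥ 0 on negative edges and ≥ 2 on positive ones;
-- the latter gives d⁻(a) + d⁻(b) ≤ k.  Double counting yields ∑ d⁻² ≤ ∑ d⁻d⁺ ≤ kP and
-- ∑ d⁻ = 2M, Cauchy–Schwarz gives (2M)² ≤ k²P, and then P − M ≥ −k²/16.
--
-- Upper bound.  Graphs are blow-ups of small signed patterns: each class is an independent set
-- or a clique, and the edges between two classes all carry one sign.  All SEDF conditions and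
-- the weight then only depend on the block sizes.  A six-class family with blocks t, t, 2t + 1,
-- 3t, 3t plus r ≤ 9 isolated vertices handles every k ≥ 21; the cases 12 ≤ k ≤ 20 are concrete
-- blueprints checked by evaluation.

module Submission where

open import Defs
open import Data.Nat using (ℕ; _≥_)
open import Data.Integer using (ℤ; +_; -_; _-_; _*_)
open import Data.Product using (_×_)

open import Data.Bool using (Bool; true; false; T; not; _∧_; _∨_; if_then_else_)
import Data.Bool.Properties as BoolP
open import Data.Nat as ℕ using (zero; suc; _<ᵇ_; _<_; z≤n; s≤s)
import Data.Nat.Properties as ℕP
open import Data.Nat.DivMod using (_/_; _%_; m%n<n; m≡m%n+[m/n]*n)
import Data.Nat.Tactic.RingSolver as ℕSolver
open import Data.Fin using (Fin; zero; suc; toℕ; _≟_; punchIn; splitAt; _↑ˡ_; _↑ʳ_)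
import Data.Fin.Properties as FinP
open import Data.Integer as ℤ using (_+_; _≤_; -[1+_]; +≤+; nonNegative)
import Data.Integer.Properties as ℤP
open import Data.Integer.Tactic.RingSolver using (solve-∀)
open import Data.List as List using (List; []; _∷_; _++_; length; lookup; map; concatMap; foldr; tabulate; allFin)
import Data.List.Properties as ListP
open import Data.List.Relation.Unary.All as All using (All; []; _∷_)
import Data.List.Relation.Unary.All.Properties as AllP
open import Data.List.Membership.Propositional.Properties using (∈-lookup)
open import Data.Product using (_,_; proj₁; proj₂)
open import Relation.Nullary.Decidable using (_×-dec_)
open import Data.Sign using (Sign)
open import Data.Maybe using (Maybe; just; nothing; is-just; fromMaybe)
import Data.Maybe.Properties as MaybeP
open import Data.Vec as Vec using (Vec; _∷_; [])
import Data.Sign.Properties as SignP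
open import Data.Sum using ([_,_]′)
open import Data.Unit using (⊤; tt)
open import Data.Empty using (⊥-elim)
open import Function.Bundles using (Equivalence)
open import Relation.Binary.Definitions using (tri<; tri≈; tri>)
open import Function using (_∘_)
open import Relation.Nullary using (¬_; Dec; yes; no)
open import Relation.Nullary.Decidable using (does; isYes≗does; dec-true; True; False; toWitness; toWitnessFalse)
open import Relation.Binary.PropositionalEquality as ≡
  using (_≡_; _≢_; refl; trans; cong; cong₂; subst; module ≡-Reasoning)
open import Algebra.Properties.AbelianGroup ℤP.+-0-abelianGroup
  using () renaming (∙-cancelˡ to +-cancelˡ)
open import Algebra.Properties.Semiring.Sum ℤP.+-*-semiring
  using (sum-syntax; sum-cong-≗; ∑-distrib-+; ∑-comm; *-distribˡ-sum; *-distribʳ-sum; sum-replicate-zero; sum-remove)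

infixr 7 _⊙_
_⊙_ : Bool → ℤ → ℤ
b ⊙ x = if b then x else + 0

_==_ : ∀ {n} → Fin n → Fin n → Bool
a == b = does (a ≟ b)

==-refl : ∀ {n} (a : Fin n) → (a == a) ≡ true
==-refl a = dec-true (a ≟ a) refl

==-sym : ∀ {n} (a b : Fin n) → (a == b) ≡ (b == a)
==-sym a b with a ≟ b | b ≟ a
... | yes _ | yes _ = refl
... | no  _ | no  _ = refl
... | yes p | no ¬q = ⊥-elim (¬q (≡.sym p))
... | no ¬p | yes q = ⊥-elim (¬p (≡.sym q))

sumFin≡∑ : ∀ n (g : Fin n → ℤ) → sumFin n g ≡ ∑[ i < n ] g i
sumFin≡∑ zero    g = refl
sumFin≡∑ (suc n) g = cong (λ s → g zero + s) (sumFin≡∑ n (g ∘ suc))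

∑-neg : ∀ n (g : Fin n → ℤ) → ∑[ i < n ] (- g i) ≡ - ∑[ i < n ] g i
∑-neg zero    g = refl
∑-neg (suc n) g =
  trans (cong (λ s → - g zero + s) (∑-neg n (g ∘ suc))) (≡.sym (ℤP.neg-distrib-+ (g zero) _))

∑-const : ∀ n c → ∑[ i < n ] c ≡ + n * c
∑-const zero    c = ≡.sym (ℤP.*-zeroˡ c)
∑-const (suc n) c = trans (cong (λ s → c + s) (∑-const n c)) (≡.sym (ℤP.suc-* (+ n) c))

∑-scale : ∀ n c (g : Fin n → ℤ) → ∑[ i < n ] (c * g i) ≡ c * ∑[ i < n ] g i
∑-scale n c g = ≡.sym (*-distribˡ-sum c g)

∑-mono : ∀ n {g h : Fin n → ℤ} → (∀ i → g i ≤ h i) → ∑[ i < n ] g i ≤ ∑[ i < n ] h i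
∑-mono zero    g≤h = ℤP.≤-refl
∑-mono (suc n) g≤h = ℤP.+-mono-≤ (g≤h zero) (∑-mono n (g≤h ∘ suc))

∑-nonneg : ∀ n (g : Fin n → ℤ) → (∀ i → + 0 ≤ g i) → + 0 ≤ ∑[ i < n ] g i
∑-nonneg n g 0≤g = subst (_≤ ∑[ i < n ] g i) (sum-replicate-zero n) (∑-mono n {λ _ → + 0} 0≤g)

∑-vanish : ∀ {n} {g : Fin n → ℤ} → (∀ i → g i ≡ + 0) → ∑[ i < n ] g i ≡ + 0
∑-vanish {n} g≡0 = trans (sum-cong-≗ g≡0) (sum-replicate-zero n)

⊙-nonneg : ∀ b → + 0 ≤ b ⊙ + 1
⊙-nonneg true  = +≤+ z≤n
⊙-nonneg false = +≤+ z≤n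

∑-⊙ : ∀ n b (g : Fin n → ℤ) → ∑[ i < n ] (b ⊙ g i) ≡ b ⊙ ∑[ i < n ] g i
∑-⊙ n true  g = refl
∑-⊙ n false g = sum-replicate-zero n

∑-point : ∀ n (a : Fin n) (g : Fin n → ℤ) → ∑[ i < n ] ((a == i) ⊙ g i) ≡ g a
∑-point (suc n) zero    g = trans (cong (λ s → g zero + s) (sum-replicate-zero n)) (ℤP.+-identityʳ (g zero))
∑-point (suc n) (suc a) g = trans (ℤP.+-identityˡ _) (∑-point n a (g ∘ suc))

∑-point′ : ∀ n (a : Fin n) (g : Fin n → ℤ) → ∑[ i < n ] ((i == a) ⊙ g i) ≡ g a
∑-point′ n a g = trans (sum-cong-≗ (λ i → cong (_⊙ g i) (==-sym i a))) (∑-point n a g)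

nonneg-+-zero : ∀ {x y} → + 0 ≤ x → + 0 ≤ y → x + y ≡ + 0 → x ≡ + 0 × y ≡ + 0
nonneg-+-zero {+ zero}   {+ zero}   _  _  _  = refl , refl
nonneg-+-zero {+ zero}   {+ suc _}  _  _  ()
nonneg-+-zero {+ suc _}  {+ _}      _  _  ()
nonneg-+-zero { -[1+ _ ]} {_}       () _  _
nonneg-+-zero {+ _}      { -[1+ _ ]} _ () _

∑-nonneg-zero : ∀ n (g : Fin n → ℤ) → (∀ i → + 0 ≤ g i) → ∑[ i < n ] g i ≡ + 0 → ∀ i → g i ≡ + 0
∑-nonneg-zero (suc n) g 0≤g total zero =
  proj₁ (nonneg-+-zero (0≤g zero) (∑-nonneg n (g ∘ suc) (0≤g ∘ suc)) total)
∑-nonneg-zero (suc n) g 0≤g total (suc i) =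
  ∑-nonneg-zero n (g ∘ suc) (0≤g ∘ suc)
    (proj₂ (nonneg-+-zero (0≤g zero) (∑-nonneg n (g ∘ suc) (0≤g ∘ suc)) total)) i

∑-select : ∀ n (p : Fin n → Bool) (x : Fin n → ℤ) (e : Fin n) → p e ≡ true →
           ∑[ i < n ] (p i ⊙ + 1) ≡ + 1 → ∑[ i < n ] (p i ⊙ x i) ≡ x e
∑-select (suc n) p x e pe mass = begin
  ∑[ i < suc n ] (p i ⊙ x i)                       ≡⟨ sum-remove {i = e} (λ i → p i ⊙ x i) ⟩
  p e ⊙ x e + ∑[ j < n ] (p (punchIn e j) ⊙ x (punchIn e j))
                                                  ≡⟨ cong₂ _+_ (cong (_⊙ x e) pe) (∑-vanish others-vanish) ⟩
  x e + + 0                                       ≡⟨ ℤP.+-identityʳ (x e) ⟩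
  x e                                             ∎
  where
  open ≡-Reasoning
  others-mass : ∑[ j < n ] (p (punchIn e j) ⊙ + 1) ≡ + 0
  others-mass = +-cancelˡ (+ 1) _ (+ 0) (begin
    + 1 + ∑[ j < n ] (p (punchIn e j) ⊙ + 1)       ≡⟨ cong (λ b → b ⊙ + 1 + ∑[ j < n ] (p (punchIn e j) ⊙ + 1)) pe ⟨
    p e ⊙ + 1 + ∑[ j < n ] (p (punchIn e j) ⊙ + 1) ≡⟨ sum-remove {i = e} (λ i → p i ⊙ + 1) ⟨
    ∑[ i < suc n ] (p i ⊙ + 1)                     ≡⟨ mass ⟩
    + 1                                             ∎)
  others-vanish : ∀ j → p (punchIn e j) ⊙ x (punchIn e j) ≡ + 0
  others-vanish j with p (punchIn e j) | ∑-nonneg-zero n _ (λ j → ⊙-nonneg (p (punchIn e j))) others-mass j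
  ... | false | _  = refl
  ... | true  | ()

⊙-∨ : ∀ x y w → (x ∨ y) ⊙ w + (x ∧ y) ⊙ w ≡ x ⊙ w + y ⊙ w
⊙-∨ true  true  w = refl
⊙-∨ true  false w = refl
⊙-∨ false true  w = ℤP.+-comm w (+ 0)
⊙-∨ false false w = refl

⊙-swap : ∀ b c w → b ⊙ c ⊙ w ≡ c ⊙ b ⊙ w
⊙-swap true  c     w = refl
⊙-swap false true  w = refl
⊙-swap false false w = refl

⊙-+ : ∀ b x y → b ⊙ (x + y) ≡ b ⊙ x + b ⊙ y
⊙-+ true  x y = refl
⊙-+ false x y = refl

⊙-neg : ∀ b x → b ⊙ (- x) ≡ - (b ⊙ x)
⊙-neg true  x = refl
⊙-neg false x = refl

⊙-≤ : ∀ b → b ⊙ + 1 ≤ + 1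
⊙-≤ true  = ℤP.≤-refl
⊙-≤ false = +≤+ z≤n

*-⊙ : ∀ x b w → x * (b ⊙ w) ≡ b ⊙ (x * w)
*-⊙ x true  w = refl
*-⊙ x false w = ℤP.*-zeroʳ x

==-∧-distinct : ∀ {n} {a b : Fin n} → toℕ a < toℕ b → ∀ v → ((v == a) ∧ (v == b)) ≡ false
==-∧-distinct {a = a} {b} a<b v with v ≟ a | v ≟ b
... | yes refl | yes refl = ⊥-elim (ℕP.<-irrefl refl a<b)
... | yes _    | no _     = refl
... | no _     | _        = refl

⊙-∨-distinct : ∀ {n} {a b : Fin n} → toℕ a < toℕ b → ∀ v w →
               ((v == a) ∨ (v == b)) ⊙ w ≡ (v == a) ⊙ w + (v == b) ⊙ w
⊙-∨-distinct {a = a} {b} a<b v w = begin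
  (x ∨ y) ⊙ w                 ≡⟨ ℤP.+-identityʳ _ ⟨
  (x ∨ y) ⊙ w + + 0           ≡⟨ cong (λ c → (x ∨ y) ⊙ w + c ⊙ w) (==-∧-distinct a<b v) ⟨
  (x ∨ y) ⊙ w + (x ∧ y) ⊙ w   ≡⟨ ⊙-∨ x y w ⟩
  x ⊙ w + y ⊙ w               ∎
  where
  open ≡-Reasoning
  x y : Bool
  x = v == a
  y = v == b

both-ends : ∀ {n} {a b c d : Fin n} → toℕ a < toℕ b → toℕ c < toℕ d →
  (((a == c) ∨ (a == d)) ∧ ((b == c) ∨ (b == d))) ≡ ((a == c) ∧ (b == d))
both-ends {a = a} {b} {c} {d} a<b c<d with a ≟ c | a ≟ d | b ≟ c | b ≟ d
... | yes refl | _        | yes refl | _        = ⊥-elim (ℕP.<-irrefl refl a<b)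
... | yes refl | _        | no _     | _        = refl
... | no _     | yes refl | yes refl | _        = ⊥-elim (ℕP.<-asym a<b c<d)
... | no _     | yes refl | no _     | yes refl = ⊥-elim (ℕP.<-irrefl refl a<b)
... | no _     | yes refl | no _     | no _     = refl
... | no _     | no _     | _        | _        = refl

<ᵇ-true : ∀ {m n} → m < n → (m <ᵇ n) ≡ true
<ᵇ-true m<n = Equivalence.to BoolP.T-≡ (ℕP.<⇒<ᵇ m<n)

<ᵇ-false : ∀ {m n} → ¬ m < n → (m <ᵇ n) ≡ false
<ᵇ-false {m} {n} m≮n with m <ᵇ n in eq
... | false = refl
... | true  = ⊥-elim (m≮n (ℕP.<ᵇ⇒< m n (Equivalence.from BoolP.T-≡ eq)))

lsum : List ℤ → ℤ
lsum = foldr _+_ (+ 0)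

lsum-++ : ∀ xs ys → lsum (xs ++ ys) ≡ lsum xs + lsum ys
lsum-++ []       ys = ≡.sym (ℤP.+-identityˡ (lsum ys))
lsum-++ (x ∷ xs) ys = trans (cong (λ s → x + s) (lsum-++ xs ys)) (≡.sym (ℤP.+-assoc x _ _))

∑-lookup : ∀ {A : Set} (l : List A) (h : A → ℤ) → ∑[ i < length l ] h (lookup l i) ≡ lsum (map h l)
∑-lookup []      h = refl
∑-lookup (x ∷ l) h = cong (λ s → h x + s) (∑-lookup l h)

lsum-tabulate : ∀ n (t : Fin n → ℤ) → lsum (tabulate t) ≡ ∑[ i < n ] t i
lsum-tabulate zero    t = refl
lsum-tabulate (suc n) t = cong (λ s → t zero + s) (lsum-tabulate n (t ∘ suc))

lsum-allFin : ∀ n (g : Fin n → ℤ) → lsum (map g (allFin n)) ≡ ∑[ i < n ] g i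
lsum-allFin n g = trans (cong lsum (ListP.map-tabulate (λ i → i) g)) (lsum-tabulate n g)

lsum-concatMap : ∀ {A B : Set} (g : A → List B) (h : B → ℤ) (xs : List A) →
                 lsum (map h (concatMap g xs)) ≡ lsum (map (λ a → lsum (map h (g a))) xs)
lsum-concatMap g h []       = refl
lsum-concatMap g h (a ∷ xs) = begin
  lsum (map h (g a ++ concatMap g xs))                ≡⟨ cong lsum (ListP.map-++ h (g a) _) ⟩
  lsum (map h (g a) ++ map h (concatMap g xs))        ≡⟨ lsum-++ (map h (g a)) _ ⟩
  lsum (map h (g a)) + lsum (map h (concatMap g xs))  ≡⟨ cong (λ s → lsum (map h (g a)) + s) (lsum-concatMap g h xs) ⟩
  lsum (map h (g a)) + lsum (map (λ a → lsum (map h (g a))) xs) ∎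
  where open ≡-Reasoning

module _ {k : ℕ} (G : Graph k) where

  listed : Fin k → Fin k → Bool
  listed i j = (toℕ i <ᵇ toℕ j) ∧ adj G i j

  private
    cell : Fin k → Fin k → List (Fin k × Fin k)
    cell i j = if listed i j then (i , j) ∷ [] else []

  ∑-edges : (h : Fin k × Fin k → ℤ) →
            ∑[ e < nE G ] h (ends G e) ≡ ∑[ i < k ] ∑[ j < k ] (listed i j ⊙ h (i , j))
  ∑-edges h = begin
    ∑[ e < nE G ] h (ends G e)                                 ≡⟨ ∑-lookup (edges G) h ⟩
    lsum (map h (edges G))                                     ≡⟨ lsum-concatMap row h (allFin k) ⟩
    lsum (map (λ i → lsum (map h (row i))) (allFin k))         ≡⟨ lsum-allFin k _ ⟩
    ∑[ i < k ] lsum (map h (row i))                            ≡⟨ sum-cong-≗ row-sum ⟩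
    ∑[ i < k ] ∑[ j < k ] (listed i j ⊙ h (i , j))             ∎
    where
    open ≡-Reasoning
    row : Fin k → List (Fin k × Fin k)
    row i = concatMap (cell i) (allFin k)
    cell-sum : ∀ i j → lsum (map h (cell i j)) ≡ listed i j ⊙ h (i , j)
    cell-sum i j with listed i j
    ... | true  = ℤP.+-identityʳ (h (i , j))
    ... | false = refl
    row-sum : ∀ i → lsum (map h (row i)) ≡ ∑[ j < k ] (listed i j ⊙ h (i , j))
    row-sum i = trans (lsum-concatMap (cell i) h (allFin k))
                      (trans (lsum-allFin k _) (sum-cong-≗ (cell-sum i)))

  edges-listed : All (λ p → T (listed (proj₁ p) (proj₂ p))) (edges G)
  edges-listed = AllP.concat⁺ (AllP.map⁺ (All.universal row-listed (allFin k)))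
    where
    cell-listed : ∀ i j → All (λ p → T (listed (proj₁ p) (proj₂ p))) (cell i j)
    cell-listed i j with listed i j in eq
    ... | true  = subst T (≡.sym eq) _ ∷ []
    ... | false = []
    row-listed : ∀ i → All (λ p → T (listed (proj₁ p) (proj₂ p))) (concatMap (cell i) (allFin k))
    row-listed i = AllP.concat⁺ (AllP.map⁺ (All.universal (cell-listed i) (allFin k)))

  src tgt : Edge G → Fin k
  src e = proj₁ (ends G e)
  tgt e = proj₂ (ends G e)

  edge-listed : ∀ e → T (listed (src e) (tgt e))
  edge-listed e = All.lookup edges-listed (∈-lookup e)

  listed⇒< : ∀ i j → T (listed i j) → toℕ i < toℕ j
  listed⇒< i j l = ℕP.<ᵇ⇒< (toℕ i) (toℕ j) (proj₁ (Equivalence.to BoolP.T-∧ l))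

  src<tgt : ∀ e → toℕ (src e) < toℕ (tgt e)
  src<tgt e = listed⇒< (src e) (tgt e) (edge-listed e)

  edge-adj : ∀ e → adj G (src e) (tgt e) ≡ true
  edge-adj e = Equivalence.to BoolP.T-≡ (proj₂ (Equivalence.to BoolP.T-∧ (edge-listed e)))

  listed-either : ∀ v j w → listed v j ⊙ w + listed j v ⊙ w ≡ adj G v j ⊙ w
  listed-either v j w rewrite Graph.sym G j v with ℕP.<-cmp (toℕ v) (toℕ j)
  ... | tri< v<j _ j≮v rewrite <ᵇ-true v<j | <ᵇ-false j≮v = ℤP.+-identityʳ _
  ... | tri> v≮j _ j<v rewrite <ᵇ-false v≮j | <ᵇ-true j<v = ℤP.+-identityˡ _
  ... | tri≈ v≮j v≡j j≮v
    rewrite <ᵇ-false v≮j | <ᵇ-false j≮v | FinP.toℕ-injective v≡j | irrefl G j = refl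

  inc : Fin k → Edge G → Bool
  inc v e = (v == src e) ∨ (v == tgt e)

  star : (Edge G → ℤ) → Fin k → ℤ
  star w v = ∑[ e < nE G ] (inc v e ⊙ w e)

  ∑-endpoints : ∀ e (y : Fin k → ℤ) → ∑[ v < k ] (inc v e ⊙ y v) ≡ y (src e) + y (tgt e)
  ∑-endpoints e y = begin
    ∑[ v < k ] (inc v e ⊙ y v)                                   ≡⟨ sum-cong-≗ (λ v → ⊙-∨-distinct (src<tgt e) v (y v)) ⟩
    ∑[ v < k ] ((v == src e) ⊙ y v + (v == tgt e) ⊙ y v)         ≡⟨ ∑-distrib-+ {k} _ _ ⟩
    ∑[ v < k ] ((v == src e) ⊙ y v) + ∑[ v < k ] ((v == tgt e) ⊙ y v)
                                                                  ≡⟨ cong₂ _+_ (∑-point′ k (src e) y) (∑-point′ k (tgt e) y) ⟩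
    y (src e) + y (tgt e)                                         ∎
    where open ≡-Reasoning

  ∑-star : ∀ (x : Fin k → ℤ) (w : Edge G → ℤ) →
           ∑[ v < k ] (x v * star w v) ≡ ∑[ e < nE G ] ((x (src e) + x (tgt e)) * w e)
  ∑-star x w = begin
    ∑[ v < k ] (x v * star w v)                                   ≡⟨ sum-cong-≗ (λ v → *-distribˡ-sum {nE G} (x v) _) ⟩
    ∑[ v < k ] ∑[ e < nE G ] (x v * (inc v e ⊙ w e))              ≡⟨ ∑-comm {k} {nE G} _ ⟩
    ∑[ e < nE G ] ∑[ v < k ] (x v * (inc v e ⊙ w e))              ≡⟨ sum-cong-≗ per-edge ⟩
    ∑[ e < nE G ] ((x (src e) + x (tgt e)) * w e)                 ∎
    where
    open ≡-Reasoning
    per-edge : ∀ e → ∑[ v < k ] (x v * (inc v e ⊙ w e)) ≡ (x (src e) + x (tgt e)) * w e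
    per-edge e = trans (sum-cong-≗ (λ v → *-⊙ (x v) (inc v e) (w e)))
                   (trans (∑-endpoints e (λ v → x v * w e)) (≡.sym (ℤP.*-distribʳ-+ (w e) (x (src e)) (x (tgt e)))))

  star-+ : ∀ (a b : Edge G → ℤ) v → star (λ e → a e + b e) v ≡ star a v + star b v
  star-+ a b v = trans (sum-cong-≗ (λ e → ⊙-+ (inc v e) (a e) (b e))) (∑-distrib-+ {nE G} _ _)

  star-- : ∀ (a b : Edge G → ℤ) v → star (λ e → a e - b e) v ≡ star a v - star b v
  star-- a b v = trans (star-+ a (λ e → - b e) v)
    (cong (λ s → star a v + s) (trans (sum-cong-≗ (λ e → ⊙-neg (inc v e) (b e))) (∑-neg (nE G) _)))

  star-symmetric : (W : Fin k → Fin k → ℤ) → (∀ i j → W i j ≡ W j i) → ∀ v →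
                   star (λ e → W (src e) (tgt e)) v ≡ ∑[ j < k ] (adj G v j ⊙ W v j)
  star-symmetric W W-sym v = begin
    star (λ e → W (src e) (tgt e)) v
      ≡⟨ ∑-edges (λ p → ((v == proj₁ p) ∨ (v == proj₂ p)) ⊙ W (proj₁ p) (proj₂ p)) ⟩
    ∑[ i < k ] ∑[ j < k ] (listed i j ⊙ ((v == i) ∨ (v == j)) ⊙ W i j)
      ≡⟨ sum-cong-≗ (λ i → trans (sum-cong-≗ (split i)) (∑-distrib-+ {k} _ _)) ⟩
    ∑[ i < k ] (∑[ j < k ] (listed i j ⊙ (v == i) ⊙ W i j) + ∑[ j < k ] (listed i j ⊙ (v == j) ⊙ W i j))
      ≡⟨ ∑-distrib-+ {k} _ _ ⟩
    ∑[ i < k ] ∑[ j < k ] (listed i j ⊙ (v == i) ⊙ W i j) + ∑[ i < k ] ∑[ j < k ] (listed i j ⊙ (v == j) ⊙ W i j)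
      ≡⟨ cong₂ _+_ from-v into-v ⟩
    ∑[ j < k ] (listed v j ⊙ W v j) + ∑[ j < k ] (listed j v ⊙ W v j)
      ≡⟨ ∑-distrib-+ {k} _ _ ⟨
    ∑[ j < k ] (listed v j ⊙ W v j + listed j v ⊙ W v j)
      ≡⟨ sum-cong-≗ (λ j → listed-either v j (W v j)) ⟩
    ∑[ j < k ] (adj G v j ⊙ W v j) ∎
    where
    open ≡-Reasoning
    split : ∀ i j → listed i j ⊙ ((v == i) ∨ (v == j)) ⊙ W i j
                  ≡ listed i j ⊙ (v == i) ⊙ W i j + listed i j ⊙ (v == j) ⊙ W i j
    split i j with listed i j in eq
    ... | true  = ⊙-∨-distinct (listed⇒< i j (Equivalence.from BoolP.T-≡ eq)) v (W i j)
    ... | false = refl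
    from-v : ∑[ i < k ] ∑[ j < k ] (listed i j ⊙ (v == i) ⊙ W i j) ≡ ∑[ j < k ] (listed v j ⊙ W v j)
    from-v = trans (sum-cong-≗ (λ i → trans (sum-cong-≗ (λ j → ⊙-swap (listed i j) (v == i) (W i j)))
                                            (∑-⊙ k (v == i) _)))
                   (∑-point k v _)
    into-v : ∑[ i < k ] ∑[ j < k ] (listed i j ⊙ (v == j) ⊙ W i j) ≡ ∑[ j < k ] (listed j v ⊙ W v j)
    into-v = sum-cong-≗ (λ i → trans (sum-cong-≗ (λ j → ⊙-swap (listed i j) (v == j) (W i j)))
                                     (trans (∑-point k v _) (cong (listed i v ⊙_) (W-sym i v))))

  ∑-both-ends : ∀ e (w : Edge G → ℤ) → ∑[ e′ < nE G ] ((inc (src e) e′ ∧ inc (tgt e) e′) ⊙ w e′) ≡ w e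
  ∑-both-ends e w = begin
    ∑[ e′ < nE G ] ((inc a e′ ∧ inc b e′) ⊙ w e′)
      ≡⟨ sum-cong-≗ (λ e′ → cong (_⊙ w e′) (both-ends (src<tgt e) (src<tgt e′))) ⟩
    ∑[ e′ < nE G ] (same e′ ⊙ w e′)
      ≡⟨ ∑-select (nE G) same w e (cong₂ _∧_ (==-refl a) (==-refl b)) mass ⟩
    w e ∎
    where
    open ≡-Reasoning
    a b : Fin k
    a = src e
    b = tgt e
    same : Edge G → Bool
    same e′ = (a == src e′) ∧ (b == tgt e′)
    shuffle : ∀ l x y → l ⊙ (x ∧ y) ⊙ + 1 ≡ x ⊙ y ⊙ l ⊙ + 1
    shuffle l     true  y     = ⊙-swap l y (+ 1)
    shuffle true  false y     = refl
    shuffle false false y     = refl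
    mass : ∑[ e′ < nE G ] (same e′ ⊙ + 1) ≡ + 1
    mass = begin
      ∑[ e′ < nE G ] (same e′ ⊙ + 1)
        ≡⟨ ∑-edges (λ p → ((a == proj₁ p) ∧ (b == proj₂ p)) ⊙ + 1) ⟩
      ∑[ i < k ] ∑[ j < k ] (listed i j ⊙ ((a == i) ∧ (b == j)) ⊙ + 1)
        ≡⟨ sum-cong-≗ (λ i → trans (sum-cong-≗ (λ j → shuffle (listed i j) (a == i) (b == j))) (∑-⊙ k (a == i) _)) ⟩
      ∑[ i < k ] ((a == i) ⊙ ∑[ j < k ] ((b == j) ⊙ listed i j ⊙ + 1))
        ≡⟨ ∑-point k a _ ⟩
      ∑[ j < k ] ((b == j) ⊙ listed a j ⊙ + 1)
        ≡⟨ ∑-point k b _ ⟩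
      listed a b ⊙ + 1
        ≡⟨ cong (_⊙ + 1) (Equivalence.to BoolP.T-≡ (edge-listed e)) ⟩
      + 1 ∎

  shareEnd≡inc : ∀ e e′ → shareEnd G e e′ ≡ (inc (src e) e′ ∨ inc (tgt e) e′)
  shareEnd≡inc e e′ = begin
    shareEnd G e e′
      ≡⟨ cong₂ _∨_ (isYes≗does (a ≟ c)) (cong₂ _∨_ (isYes≗does (a ≟ d)) (cong₂ _∨_ (isYes≗does (b ≟ c)) (isYes≗does (b ≟ d)))) ⟩
    (a == c) ∨ (a == d) ∨ (b == c) ∨ (b == d)
      ≡⟨ BoolP.∨-assoc (a == c) (a == d) _ ⟨
    ((a == c) ∨ (a == d)) ∨ (b == c) ∨ (b == d) ∎
    where
    open ≡-Reasoning
    a b c d : Fin k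
    a = src e
    b = tgt e
    c = src e′
    d = tgt e′

+≡⇒≡- : ∀ {x y z} → x + y ≡ z → x ≡ z - y
+≡⇒≡- {x} {y} eq = trans (x≡x+y-y x y) (cong (_- y) eq)
  where
  x≡x+y-y : ∀ x y → x ≡ x + y - y
  x≡x+y-y = solve-∀

module _ {k : ℕ} (G : Graph k) (f : Labelling G) where

  fval : Edge G → ℤ
  fval e = val (f e)

  -- f[N[e]] = σ(a) + σ(b) − f(e), where σ(v) = ∑_{e′ ∋ v} f(e′) and e = ab:
  -- by inclusion–exclusion, the only edge counted at both a and b is e itself.
  closedSum-star : ∀ e → closedSum G f e ≡ star G fval (src G e) + star G fval (tgt G e) - fval e
  closedSum-star e = trans (sumFin≡∑ (nE G) _) (+≡⇒≡- (begin
    ∑[ e′ < nE G ] (shareEnd G e e′ ⊙ fval e′) + fval e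
      ≡⟨ cong₂ _+_ (sum-cong-≗ (λ e′ → cong (_⊙ fval e′) (shareEnd≡inc G e e′))) (≡.sym (∑-both-ends G e fval)) ⟩
    ∑[ e′ < nE G ] ((x e′ ∨ y e′) ⊙ fval e′) + ∑[ e′ < nE G ] ((x e′ ∧ y e′) ⊙ fval e′)
      ≡⟨ ∑-distrib-+ {nE G} _ _ ⟨
    ∑[ e′ < nE G ] ((x e′ ∨ y e′) ⊙ fval e′ + (x e′ ∧ y e′) ⊙ fval e′)
      ≡⟨ sum-cong-≗ (λ e′ → ⊙-∨ (x e′) (y e′) (fval e′)) ⟩
    ∑[ e′ < nE G ] (x e′ ⊙ fval e′ + y e′ ⊙ fval e′)
      ≡⟨ ∑-distrib-+ {nE G} _ _ ⟩
    star G fval (src G e) + star G fval (tgt G e) ∎))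
    where
    open ≡-Reasoning
    x y : Edge G → Bool
    x = inc G (src G e)
    y = inc G (tgt G e)

square-nonneg : ∀ x → + 0 ≤ x * x
square-nonneg (+ n)    = subst (+ 0 ≤_) (ℤP.pos-* n n) (+≤+ z≤n)
square-nonneg -[1+ n ] = +≤+ z≤n

*-monoˡ-≤ : ∀ {c a b} → + 0 ≤ c → a ≤ b → c * a ≤ c * b
*-monoˡ-≤ {c} 0≤c = ℤP.*-monoˡ-≤-nonNeg c {{nonNegative 0≤c}}

-- Cauchy–Schwarz: (∑ xᵢ)² ≤ n ∑ xᵢ², because ∑ᵢ∑ⱼ (xᵢ − xⱼ)² = 2n ∑ xᵢ² − 2 (∑ xᵢ)² ≥ 0.
cauchy-schwarz : ∀ n (x : Fin n → ℤ) →
                 ∑[ i < n ] x i * ∑[ i < n ] x i ≤ + n * ∑[ i < n ] (x i * x i)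
cauchy-schwarz n x =
  ℤP.*-cancelˡ-≤-pos _ _ (+ 2) (ℤP.0≤i-j⇒j≤i (subst (+ 0 ≤_) spread≡ spread-nonneg))
  where
  open ≡-Reasoning
  S Q : ℤ
  S = ∑[ i < n ] x i
  Q = ∑[ i < n ] (x i * x i)
  expand : ∀ a b → (a - b) * (a - b) ≡ a * a + b * b - + 2 * (a * b)
  expand = solve-∀
  regroup : ∀ m p s → m * p + m * p - + 2 * (s * s) ≡ + 2 * (m * p) - + 2 * (s * s)
  regroup = solve-∀
  spread-nonneg : + 0 ≤ ∑[ i < n ] ∑[ j < n ] ((x i - x j) * (x i - x j))
  spread-nonneg = ∑-nonneg n _ (λ i → ∑-nonneg n _ (λ j → square-nonneg (x i - x j)))
  row : ∀ i → ∑[ j < n ] ((x i - x j) * (x i - x j)) ≡ + n * (x i * x i) + Q - + 2 * (x i * S)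
  row i = begin
    ∑[ j < n ] ((x i - x j) * (x i - x j))
      ≡⟨ sum-cong-≗ (λ j → expand (x i) (x j)) ⟩
    ∑[ j < n ] (x i * x i + x j * x j - + 2 * (x i * x j))
      ≡⟨ ∑-distrib-+ {n} _ _ ⟩
    ∑[ j < n ] (x i * x i + x j * x j) + ∑[ j < n ] (- (+ 2 * (x i * x j)))
      ≡⟨ cong₂ _+_ (∑-distrib-+ {n} _ _) (∑-neg n _) ⟩
    ∑[ j < n ] (x i * x i) + Q - ∑[ j < n ] (+ 2 * (x i * x j))
      ≡⟨ cong₂ (λ a b → a + Q - b) (∑-const n _) (trans (∑-scale n (+ 2) _) (cong (+ 2 *_) (∑-scale n (x i) x))) ⟩
    + n * (x i * x i) + Q - + 2 * (x i * S) ∎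
  spread≡ : ∑[ i < n ] ∑[ j < n ] ((x i - x j) * (x i - x j)) ≡ + 2 * (+ n * Q) - + 2 * (S * S)
  spread≡ = begin
    ∑[ i < n ] ∑[ j < n ] ((x i - x j) * (x i - x j))
      ≡⟨ sum-cong-≗ row ⟩
    ∑[ i < n ] (+ n * (x i * x i) + Q - + 2 * (x i * S))
      ≡⟨ trans (∑-distrib-+ {n} _ _) (cong₂ _+_ (∑-distrib-+ {n} _ _) (∑-neg n _)) ⟩
    ∑[ i < n ] (+ n * (x i * x i)) + ∑[ i < n ] Q - ∑[ i < n ] (+ 2 * (x i * S))
      ≡⟨ cong₂ (λ a b → a + ∑[ i < n ] Q - b) (∑-scale n (+ n) _)
               (trans (∑-scale n (+ 2) _) (cong (+ 2 *_) (≡.sym (*-distribʳ-sum {n} S x)))) ⟩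
    + n * Q + ∑[ i < n ] Q - + 2 * (S * S)
      ≡⟨ cong (λ q → + n * Q + q - + 2 * (S * S)) (∑-const n Q) ⟩
    + n * Q + + n * Q - + 2 * (S * S)
      ≡⟨ regroup (+ n) Q S ⟩
    + 2 * (+ n * Q) - + 2 * (S * S) ∎

-- The final estimate, without square roots: if (2M)² ≤ K²P with K > 0, then −K² ≤ 16 (P − M),
-- since K²(K² + 16 (P − M)) = (K² − 8M)² + 16 (K²P − (2M)²) ≥ 0.
quadratic-bound : ∀ n P M → let K = + suc n in
                  (+ 2 * M) * (+ 2 * M) ≤ K * K * P → - (K * K) ≤ + 16 * (P - M)
quadratic-bound n P M 4M²≤K²P = ℤP.0≤i-j⇒j≤i (ℤP.*-cancelˡ-≤-pos (+ 0) _ (K * K) (begin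
  K * K * + 0                                              ≡⟨ ℤP.*-zeroʳ (K * K) ⟩
  + 0                                                      ≤⟨ ℤP.+-mono-≤ (square-nonneg (K * K - + 8 * M))
                                                                  (*-monoˡ-≤ {+ 16} (+≤+ z≤n) (ℤP.i≤j⇒0≤j-i 4M²≤K²P)) ⟩
  (K * K - + 8 * M) * (K * K - + 8 * M) + + 16 * (K * K * P - (+ 2 * M) * (+ 2 * M))
                                                           ≡⟨ identity K P M ⟩
  K * K * (+ 16 * (P - M) - - (K * K))                     ∎))
  where
  open ℤP.≤-Reasoning
  K : ℤ
  K = + suc n
  identity : ∀ K P M → (K * K - + 8 * M) * (K * K - + 8 * M) + + 16 * (K * K * P - (+ 2 * M) * (+ 2 * M))
                       ≡ K * K * (+ 16 * (P - M) - - (K * K))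
  identity = solve-∀

degree≤ : ∀ {k} (G : Graph k) v → star G (λ _ → + 1) v ≤ + k
degree≤ {k} G v = begin
  star G (λ _ → + 1) v         ≡⟨ star-symmetric G (λ _ _ → + 1) (λ _ _ → refl) v ⟩
  ∑[ j < k ] (adj G v j ⊙ + 1) ≤⟨ ∑-mono k (λ j → ⊙-≤ (adj G v j)) ⟩
  ∑[ j < k ] (+ 1)             ≡⟨ ∑-const k (+ 1) ⟩
  + k * + 1                    ≡⟨ ℤP.*-identityʳ (+ k) ⟩
  + k                          ∎
  where open ℤP.≤-Reasoning

isPos isNeg : Sign → ℤ
isPos Sign.+ = + 1
isPos Sign.- = + 0
isNeg Sign.+ = + 0
isNeg Sign.- = + 1

val≡isPos-isNeg : ∀ s → val s ≡ isPos s - isNeg s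
val≡isPos-isNeg Sign.+ = refl
val≡isPos-isNeg Sign.- = refl

isPos+isNeg : ∀ s → isPos s + isNeg s ≡ + 1
isPos+isNeg Sign.+ = refl
isPos+isNeg Sign.- = refl

module LowerBound {n : ℕ} (G : Graph (suc n)) (f : Labelling G) (sedf : IsSEDF G f) where

  k : ℕ
  k = suc n

  pos neg : Edge G → ℤ
  pos e = isPos (f e)
  neg e = isNeg (f e)

  P M : ℤ
  P = ∑[ e < nE G ] pos e
  M = ∑[ e < nE G ] neg e

  d⁺ d⁻ σ : Fin k → ℤ
  d⁺ = star G pos
  d⁻ = star G neg
  σ  = star G (fval G f)

  σ≡d⁺-d⁻ : ∀ v → σ v ≡ d⁺ v - d⁻ v
  σ≡d⁺-d⁻ v = trans (sum-cong-≗ (λ e → cong (inc G v e ⊙_) (val≡isPos-isNeg (f e)))) (star-- G pos neg v)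

  d⁺+d⁻≡deg : ∀ v → d⁺ v + d⁻ v ≡ star G (λ _ → + 1) v
  d⁺+d⁻≡deg v = trans (≡.sym (star-+ G pos neg v)) (sum-cong-≗ (λ e → cong (inc G v e ⊙_) (isPos+isNeg (f e))))

  weight≡P-M : weight G f ≡ P - M
  weight≡P-M = begin
    weight G f                              ≡⟨ sumFin≡∑ (nE G) _ ⟩
    ∑[ e < nE G ] fval G f e                ≡⟨ sum-cong-≗ (λ e → val≡isPos-isNeg (f e)) ⟩
    ∑[ e < nE G ] (pos e - neg e)           ≡⟨ ∑-distrib-+ {nE G} _ _ ⟩
    P + ∑[ e < nE G ] (- neg e)             ≡⟨ cong (λ x → P + x) (∑-neg (nE G) neg) ⟩
    P - M                                   ∎
    where open ≡-Reasoning

  condition : ∀ e → + 1 ≤ σ (src G e) + σ (tgt G e) - fval G f e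
  condition e = subst (+ 1 ≤_) (closedSum-star G f e) (sedf e)

  at-negative : ∀ e → + 0 ≤ (σ (src G e) + σ (tgt G e)) * neg e
  at-negative e = go {σ (src G e) + σ (tgt G e)} (f e) (condition e)
    where
    go : ∀ {S} s → + 1 ≤ S - val s → + 0 ≤ S * isNeg s
    go {S} Sign.+ _    = ℤP.≤-reflexive (≡.sym (ℤP.*-zeroʳ S))
    go {S} Sign.- cond = subst (+ 0 ≤_) (shift S) (ℤP.i≤j⇒0≤j-i cond)
      where
      shift : ∀ S → S - -[1+ 0 ] - + 1 ≡ S * + 1
      shift = solve-∀

  -- At a positive edge ab: σ(a) + σ(b) ≥ 2, and since deg ≤ k this gives d⁻(a) + d⁻(b) ≤ k.
  at-positive : ∀ e → (d⁻ (src G e) + d⁻ (tgt G e)) * pos e ≤ + k * pos e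
  at-positive e = go (f e) (condition e)
    where
    a b : Fin k
    a = src G e
    b = tgt G e
    go : ∀ s → + 1 ≤ σ a + σ b - val s → (d⁻ a + d⁻ b) * isPos s ≤ + k * isPos s
    go Sign.- _    = ℤP.≤-reflexive (trans (ℤP.*-zeroʳ (d⁻ a + d⁻ b)) (≡.sym (ℤP.*-zeroʳ (+ k))))
    go Sign.+ cond = ℤP.*-monoʳ-≤-nonNeg (+ 1) (few-negatives (ℤP.0≤i-j⇒j≤i (subst (+ 0 ≤_) (shift (σ a + σ b)) (ℤP.i≤j⇒0≤j-i cond))))
      where
      shift : ∀ S → S - + 1 - + 1 ≡ S - + 2
      shift = solve-∀
      count : ∀ pa ma pb mb → + 2 * (ma + mb) ≡ (pa + ma) + (pb + mb) - ((pa - ma) + (pb - mb))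
      count = solve-∀
      double : ∀ x → x + x - + 0 ≡ + 2 * x
      double = solve-∀
      few-negatives : + 2 ≤ σ a + σ b → d⁻ a + d⁻ b ≤ + k
      few-negatives 2≤σ = ℤP.*-cancelˡ-≤-pos _ _ (+ 2) (begin
        + 2 * (d⁻ a + d⁻ b)
          ≡⟨ count (d⁺ a) (d⁻ a) (d⁺ b) (d⁻ b) ⟩
        (d⁺ a + d⁻ a) + (d⁺ b + d⁻ b) - ((d⁺ a - d⁻ a) + (d⁺ b - d⁻ b))
          ≡⟨ cong₂ (λ x y → x - y) (cong₂ _+_ (d⁺+d⁻≡deg a) (d⁺+d⁻≡deg b))
                                   (≡.sym (cong₂ _+_ (σ≡d⁺-d⁻ a) (σ≡d⁺-d⁻ b))) ⟩
        star G (λ _ → + 1) a + star G (λ _ → + 1) b - (σ a + σ b)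
          ≤⟨ ℤP.+-mono-≤ (ℤP.+-mono-≤ (degree≤ G a) (degree≤ G b))
                         (ℤP.neg-mono-≤ (ℤP.≤-trans (+≤+ z≤n) 2≤σ)) ⟩
        + k + + k - + 0
          ≡⟨ double (+ k) ⟩
        + 2 * + k ∎)
        where open ℤP.≤-Reasoning

  -- Summing σ(a) + σ(b) ≥ 0 over negative edges: ∑ d⁻(v)² ≤ ∑ d⁻(v) d⁺(v).
  ∑d⁻²≤∑d⁻d⁺ : ∑[ v < k ] (d⁻ v * d⁻ v) ≤ ∑[ v < k ] (d⁻ v * d⁺ v)
  ∑d⁻²≤∑d⁻d⁺ = ℤP.0≤i-j⇒j≤i (begin
    + 0                                                        ≤⟨ ∑-nonneg (nE G) _ at-negative ⟩
    ∑[ e < nE G ] ((σ (src G e) + σ (tgt G e)) * neg e)       ≡⟨ ∑-star G σ neg ⟨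
    ∑[ v < k ] (σ v * d⁻ v)                                    ≡⟨ sum-cong-≗ (λ v → trans (cong (_* d⁻ v) (σ≡d⁺-d⁻ v))
                                                                                          (expand (d⁺ v) (d⁻ v))) ⟩
    ∑[ v < k ] (d⁻ v * d⁺ v - d⁻ v * d⁻ v)                     ≡⟨ ∑-distrib-+ {k} (λ v → d⁻ v * d⁺ v) (λ v → - (d⁻ v * d⁻ v)) ⟩
    ∑[ v < k ] (d⁻ v * d⁺ v) + ∑[ v < k ] (- (d⁻ v * d⁻ v))    ≡⟨ cong (λ x → ∑[ v < k ] (d⁻ v * d⁺ v) + x) (∑-neg k (λ v → d⁻ v * d⁻ v)) ⟩
    ∑[ v < k ] (d⁻ v * d⁺ v) - ∑[ v < k ] (d⁻ v * d⁻ v)        ∎)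
    where
    open ℤP.≤-Reasoning
    expand : ∀ p m → (p - m) * m ≡ m * p - m * m
    expand = solve-∀

  -- Summing d⁻(a) + d⁻(b) ≤ k over positive edges: ∑ d⁻(v) d⁺(v) ≤ k P.
  ∑d⁻d⁺≤kP : ∑[ v < k ] (d⁻ v * d⁺ v) ≤ + k * P
  ∑d⁻d⁺≤kP = begin
    ∑[ v < k ] (d⁻ v * d⁺ v)                                   ≡⟨ ∑-star G d⁻ pos ⟩
    ∑[ e < nE G ] ((d⁻ (src G e) + d⁻ (tgt G e)) * pos e)     ≤⟨ ∑-mono (nE G) at-positive ⟩
    ∑[ e < nE G ] (+ k * pos e)                                ≡⟨ ∑-scale (nE G) (+ k) pos ⟩
    + k * P                                                    ∎
    where open ℤP.≤-Reasoning

  ∑d⁻≡2M : ∑[ v < k ] d⁻ v ≡ + 2 * M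
  ∑d⁻≡2M = begin
    ∑[ v < k ] d⁻ v                              ≡⟨ sum-cong-≗ (λ v → ℤP.*-identityˡ (d⁻ v)) ⟨
    ∑[ v < k ] (+ 1 * d⁻ v)                      ≡⟨ ∑-star G (λ _ → + 1) neg ⟩
    ∑[ e < nE G ] (+ 2 * neg e)                  ≡⟨ ∑-scale (nE G) (+ 2) neg ⟩
    + 2 * M                                      ∎
    where open ≡-Reasoning

  lower-bound : - (+ k * + k) ≤ + 16 * weight G f
  lower-bound = subst (λ w → - (+ k * + k) ≤ + 16 * w) (≡.sym weight≡P-M) (quadratic-bound n P M (begin
    (+ 2 * M) * (+ 2 * M)                        ≡⟨ cong₂ _*_ ∑d⁻≡2M ∑d⁻≡2M ⟨
    ∑[ v < k ] d⁻ v * ∑[ v < k ] d⁻ v            ≤⟨ cauchy-schwarz k d⁻ ⟩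
    + k * ∑[ v < k ] (d⁻ v * d⁻ v)               ≤⟨ *-monoˡ-≤ {+ k} (+≤+ z≤n) ∑d⁻²≤∑d⁻d⁺ ⟩
    + k * ∑[ v < k ] (d⁻ v * d⁺ v)               ≤⟨ *-monoˡ-≤ {+ k} (+≤+ z≤n) ∑d⁻d⁺≤kP ⟩
    + k * (+ k * P)                              ≡⟨ ℤP.*-assoc (+ k) (+ k) P ⟨
    + k * + k * P                                ∎))
    where open ℤP.≤-Reasoning

∑-↑ : ∀ a b (g : Fin (a ℕ.+ b) → ℤ) →
      ∑[ j < a ℕ.+ b ] g j ≡ ∑[ i < a ] g (i ↑ˡ b) + ∑[ i < b ] g (a ↑ʳ i)
∑-↑ zero    b g = ≡.sym (ℤP.+-identityˡ _)
∑-↑ (suc a) b g = trans (cong (λ s → g zero + s) (∑-↑ a b (g ∘ suc))) (≡.sym (ℤP.+-assoc (g zero) _ _))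

∑-except : ∀ n (a : Fin n) (g : Fin n → ℤ) → ∑[ j < n ] (not (a == j) ⊙ g j) ≡ ∑[ j < n ] g j - g a
∑-except n a g = +≡⇒≡- (begin
  ∑[ j < n ] (not (a == j) ⊙ g j) + g a
    ≡⟨ cong (λ s → ∑[ j < n ] (not (a == j) ⊙ g j) + s) (∑-point n a g) ⟨
  ∑[ j < n ] (not (a == j) ⊙ g j) + ∑[ j < n ] ((a == j) ⊙ g j)
    ≡⟨ ∑-distrib-+ {n} _ _ ⟨
  ∑[ j < n ] (not (a == j) ⊙ g j + (a == j) ⊙ g j)
    ≡⟨ sum-cong-≗ (λ j → complement (a == j) (g j)) ⟩
  ∑[ j < n ] g j ∎)
  where
  open ≡-Reasoning
  complement : ∀ b x → not b ⊙ x + b ⊙ x ≡ x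
  complement true  x = ℤP.+-identityˡ x
  complement false x = ℤP.+-identityʳ x

nonzero-weight⇒edge : ∀ {k} (G : Graph k) (f : Labelling G) → weight G f ≢ + 0 → HasEdge G
nonzero-weight⇒edge G f w≢0 = nonzero-sum (nE G) _ w≢0
  where
  nonzero-sum : ∀ n (g : Fin n → ℤ) → sumFin n g ≢ + 0 → Fin n
  nonzero-sum zero    g s≢0 = ⊥-elim (s≢0 refl)
  nonzero-sum (suc n) g s≢0 = zero

upper-target : ℕ → ℤ
upper-target k = - ((+ k - + 8) * (+ k - + 8))

-- A pattern on m classes assigns to each pair of classes c, d
-- the sign of all edges between a vertex of class c and a distinct vertex of class d
-- (nothing: no such edges).  A blueprint lists blocks (s , c) of s vertices of class c; in the
-- blow-up, every vertex of class c has signed degree σC c, so every SEDF condition is a condition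
-- on a pair of classes and the weight is a sum over the blocks.
module BlowUp {m : ℕ} (link : Fin m → Fin m → Maybe Sign) (link-sym : ∀ c d → link c d ≡ link d c) where

  Blueprint : Set
  Blueprint = List (ℕ × Fin m)

  size : Blueprint → ℕ
  size []             = 0
  size ((s , _) ∷ bp) = s ℕ.+ size bp

  classOf : (bp : Blueprint) → Fin (size bp) → Fin m
  classOf ((s , c) ∷ bp) v = [ (λ _ → c) , classOf bp ]′ (splitAt s v)

  blockSum : Blueprint → (Fin m → ℤ) → ℤ
  blockSum []             h = + 0
  blockSum ((s , c) ∷ bp) h = + s * h c + blockSum bp h

  ∑-classes : ∀ bp (h : Fin m → ℤ) → ∑[ v < size bp ] h (classOf bp v) ≡ blockSum bp h
  ∑-classes []             h = refl
  ∑-classes ((s , c) ∷ bp) h = begin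
    ∑[ v < s ℕ.+ size bp ] h (classOf ((s , c) ∷ bp) v)
      ≡⟨ ∑-↑ s (size bp) _ ⟩
    ∑[ i < s ] h (classOf ((s , c) ∷ bp) (i ↑ˡ size bp)) + ∑[ i < size bp ] h (classOf ((s , c) ∷ bp) (s ↑ʳ i))
      ≡⟨ cong₂ _+_ (sum-cong-≗ (λ i → cong (λ x → h ([ (λ _ → c) , classOf bp ]′ x)) (FinP.splitAt-↑ˡ s i (size bp))))
                   (sum-cong-≗ (λ i → cong (λ x → h ([ (λ _ → c) , classOf bp ]′ x)) (FinP.splitAt-↑ʳ s (size bp) i))) ⟩
    ∑[ i < s ] h c + ∑[ i < size bp ] h (classOf bp i)
      ≡⟨ cong₂ _+_ (∑-const s (h c)) (∑-classes bp h) ⟩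
    + s * h c + blockSum bp h ∎
    where open ≡-Reasoning

  blockSum-cong : ∀ bp {h h′ : Fin m → ℤ} → (∀ c → h c ≡ h′ c) → blockSum bp h ≡ blockSum bp h′
  blockSum-cong []             h≡h′ = refl
  blockSum-cong ((s , c) ∷ bp) h≡h′ = cong₂ (λ x y → + s * x + y) (h≡h′ c) (blockSum-cong bp h≡h′)

  blockSum-scale : ∀ bp x (h : Fin m → ℤ) → blockSum bp (λ c → x * h c) ≡ x * blockSum bp h
  blockSum-scale []             x h = ≡.sym (ℤP.*-zeroʳ x)
  blockSum-scale ((s , c) ∷ bp) x h =
    trans (cong₂ _+_ (swap (+ s) x (h c)) (blockSum-scale bp x h))
          (≡.sym (ℤP.*-distribˡ-+ x (+ s * h c) (blockSum bp h)))
    where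
    swap : ∀ s x y → s * (x * y) ≡ x * (s * y)
    swap = solve-∀

  weightOf : Maybe Sign → ℤ
  weightOf nothing  = + 0
  weightOf (just s) = val s

  -- The signed degree of a vertex of class c: all linked vertices except itself.
  σC : Blueprint → Fin m → ℤ
  σC bp c = blockSum bp (λ d → weightOf (link c d)) - weightOf (link c c)

  LinkOK : Maybe Sign → ℤ → Set
  LinkOK nothing  S = ⊤
  LinkOK (just s) S = + 1 ≤ S - val s

  linkOK? : ∀ l S → Dec (LinkOK l S)
  linkOK? nothing  S = yes tt
  linkOK? (just s) S = + 1 ℤP.≤? S - val s

  Good : Blueprint → Set
  Good bp = ∀ c d → LinkOK (link c d) (σC bp c + σC bp d)

  good? : ∀ bp → Dec (Good bp)
  good? bp = FinP.all? (λ c → FinP.all? (λ d → linkOK? (link c d) (σC bp c + σC bp d)))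

  module _ (bp : Blueprint) where

    private
      cls : Fin (size bp) → Fin m
      cls = classOf bp

    blowUp : Graph (size bp)
    blowUp = record
      { adj    = λ i j → is-just (link (cls i) (cls j)) ∧ not (i == j)
      ; sym    = λ i j → cong₂ (λ l b → is-just l ∧ not b) (link-sym (cls i) (cls j)) (==-sym i j)
      ; irrefl = λ i → trans (cong (λ b → is-just (link (cls i) (cls i)) ∧ not b) (==-refl i)) (BoolP.∧-zeroʳ _)
      }

    labelling : Labelling blowUp
    labelling e = fromMaybe Sign.+ (link (cls (src blowUp e)) (cls (tgt blowUp e)))

    blowUp-σ : ∀ v → star blowUp (fval blowUp labelling) v ≡ σC bp (cls v)
    blowUp-σ v = begin
      star blowUp (fval blowUp labelling) v
        ≡⟨ star-symmetric blowUp W (λ i j → cong (val ∘ fromMaybe Sign.+) (link-sym (cls i) (cls j))) v ⟩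
      ∑[ j < size bp ] (adj blowUp v j ⊙ W v j)
        ≡⟨ sum-cong-≗ (λ j → linked-weight (link (cls v) (cls j)) (v == j)) ⟩
      ∑[ j < size bp ] (not (v == j) ⊙ weightOf (link (cls v) (cls j)))
        ≡⟨ ∑-except (size bp) v _ ⟩
      ∑[ j < size bp ] weightOf (link (cls v) (cls j)) - weightOf (link (cls v) (cls v))
        ≡⟨ cong (_- weightOf (link (cls v) (cls v))) (∑-classes bp _) ⟩
      σC bp (cls v) ∎
      where
      open ≡-Reasoning
      W : Fin (size bp) → Fin (size bp) → ℤ
      W i j = val (fromMaybe Sign.+ (link (cls i) (cls j)))
      linked-weight : ∀ l b → (is-just l ∧ not b) ⊙ val (fromMaybe Sign.+ l) ≡ not b ⊙ weightOf l
      linked-weight nothing  true  = refl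
      linked-weight nothing  false = refl
      linked-weight (just s) true  = refl
      linked-weight (just s) false = refl

    -- In a good blueprint the labelling is an SEDF, since f[N[e]] = σC c + σC d − f(e).
    blowUp-sedf : Good bp → IsSEDF blowUp labelling
    blowUp-sedf good e = subst (+ 1 ≤_) (≡.sym closed) (linked-ok (link ca cb) (edge-adj blowUp e) (good ca cb))
      where
      ca cb : Fin m
      ca = cls (src blowUp e)
      cb = cls (tgt blowUp e)
      closed : closedSum blowUp labelling e ≡ σC bp ca + σC bp cb - val (fromMaybe Sign.+ (link ca cb))
      closed = trans (closedSum-star blowUp labelling e)
                     (cong₂ (λ x y → x + y - fval blowUp labelling e) (blowUp-σ (src blowUp e)) (blowUp-σ (tgt blowUp e)))
      linked-ok : ∀ l {x S} → (is-just l ∧ x) ≡ true → LinkOK l S → + 1 ≤ S - val (fromMaybe Sign.+ l)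
      linked-ok (just s) _ ok = ok

    blowUp-weight : + 2 * weight blowUp labelling ≡ blockSum bp (σC bp)
    blowUp-weight = begin
      + 2 * weight blowUp labelling
        ≡⟨ cong (+ 2 *_) (sumFin≡∑ (nE blowUp) _) ⟩
      + 2 * ∑[ e < nE blowUp ] fval blowUp labelling e
        ≡⟨ ∑-scale (nE blowUp) (+ 2) _ ⟨
      ∑[ e < nE blowUp ] (+ 2 * fval blowUp labelling e)
        ≡⟨ ∑-star blowUp (λ _ → + 1) (fval blowUp labelling) ⟨
      ∑[ v < size bp ] (+ 1 * star blowUp (fval blowUp labelling) v)
        ≡⟨ sum-cong-≗ (λ v → trans (ℤP.*-identityˡ _) (blowUp-σ v)) ⟩
      ∑[ v < size bp ] σC bp (cls v)
        ≡⟨ ∑-classes bp (σC bp) ⟩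
      blockSum bp (σC bp) ∎
      where open ≡-Reasoning

    blowUp-bound : ∀ {x} → Good bp → blockSum bp (σC bp) ≢ + 0 → + 36 * blockSum bp (σC bp) ≤ x →
                   gAtMostScaled (size bp) 72 x
    blowUp-bound good σ≢0 36σ≤x =
      blowUp , nonzero-weight⇒edge blowUp labelling w≢0 , labelling , blowUp-sedf good ,
      subst (_≤ _) (trans (cong (+ 36 *_) (≡.sym blowUp-weight)) (≡.sym (ℤP.*-assoc (+ 36) (+ 2) _))) 36σ≤x
      where
      w≢0 : weight blowUp labelling ≢ + 0
      w≢0 w≡0 = σ≢0 (trans (≡.sym blowUp-weight) (trans (cong (+ 2 *_) w≡0) refl))

  verified : (bp : Blueprint) → {True (good? bp)} → {False (blockSum bp (σC bp) ℤ.≟ + 0)} →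
             {True (+ 36 * blockSum bp (σC bp) ℤP.≤? upper-target (size bp))} →
             gAtMostScaled (size bp) 72 (upper-target (size bp))
  verified bp {good} {σ≢0} {ineq} = blowUp-bound bp (toWitness good) (toWitnessFalse σ≢0) (toWitness ineq)

decided : ∀ {A : Set} (a? : Dec A) → {True a?} → A
decided a? {t} = toWitness t

-- The six-class pattern of the general construction: cliques H₁, H₂ of positive edges, joined
-- positively to each other and to a clique Z of negative edges; every vertex of Y₁ (Y₂) is joined
-- negatively to all of H₁ (H₂); the class I is isolated.
pattern H₁ = zero
pattern H₂ = suc zero
pattern Z  = suc (suc zero)
pattern Y₁ = suc (suc (suc zero))
pattern Y₂ = suc (suc (suc (suc zero)))
pattern I  = suc (suc (suc (suc (suc zero))))

mainLink : Fin 6 → Fin 6 → Maybe Sign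
mainLink H₁ H₁ = just Sign.+
mainLink H₁ H₂ = just Sign.+
mainLink H₂ H₁ = just Sign.+
mainLink H₂ H₂ = just Sign.+
mainLink H₁ Z  = just Sign.+
mainLink Z  H₁ = just Sign.+
mainLink H₂ Z  = just Sign.+
mainLink Z  H₂ = just Sign.+
mainLink Z  Z  = just Sign.-
mainLink H₁ Y₁ = just Sign.-
mainLink Y₁ H₁ = just Sign.-
mainLink H₂ Y₂ = just Sign.-
mainLink Y₂ H₂ = just Sign.-
mainLink _  _  = nothing

mainLink-sym : ∀ c d → mainLink c d ≡ mainLink d c
mainLink-sym = decided (FinP.all? λ c → FinP.all? λ d → MaybeP.≡-dec SignP._≟_ (mainLink c d) (mainLink d c))

module Main = BlowUp mainLink mainLink-sym

g13 : gAtMostScaled 13 72 (upper-target 13)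
g13 = Main.verified ((2 , H₁) ∷ (1 , H₂) ∷ (3 , Z) ∷ (3 , Y₁) ∷ (4 , Y₂) ∷ [])

blueprint14 : ℕ → Main.Blueprint
blueprint14 r = (2 , H₁) ∷ (1 , H₂) ∷ (4 , Z) ∷ (4 , Y₁) ∷ (3 , Y₂) ∷ (r , I) ∷ []

-- The sporadic graph on 12 vertices, as the blow-up of a pattern on 12 classes of size one.
-- Entry 1 is a positive edge, 2 a negative edge, 0 no edge.
table12 : Vec (Vec ℕ 12) 12
table12 =
    (0 ∷ 2 ∷ 2 ∷ 1 ∷ 0 ∷ 0 ∷ 1 ∷ 0 ∷ 0 ∷ 0 ∷ 0 ∷ 0 ∷ [])
  ∷ (2 ∷ 0 ∷ 1 ∷ 1 ∷ 1 ∷ 0 ∷ 1 ∷ 0 ∷ 2 ∷ 2 ∷ 1 ∷ 0 ∷ [])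
  ∷ (2 ∷ 1 ∷ 0 ∷ 1 ∷ 2 ∷ 0 ∷ 1 ∷ 0 ∷ 0 ∷ 0 ∷ 2 ∷ 0 ∷ [])
  ∷ (1 ∷ 1 ∷ 1 ∷ 0 ∷ 1 ∷ 2 ∷ 1 ∷ 2 ∷ 1 ∷ 2 ∷ 0 ∷ 2 ∷ [])
  ∷ (0 ∷ 1 ∷ 2 ∷ 1 ∷ 0 ∷ 0 ∷ 2 ∷ 0 ∷ 0 ∷ 0 ∷ 0 ∷ 0 ∷ [])
  ∷ (0 ∷ 0 ∷ 0 ∷ 2 ∷ 0 ∷ 0 ∷ 2 ∷ 0 ∷ 0 ∷ 0 ∷ 0 ∷ 0 ∷ [])
  ∷ (1 ∷ 1 ∷ 1 ∷ 1 ∷ 2 ∷ 2 ∷ 0 ∷ 2 ∷ 1 ∷ 0 ∷ 1 ∷ 2 ∷ [])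
  ∷ (0 ∷ 0 ∷ 0 ∷ 2 ∷ 0 ∷ 0 ∷ 2 ∷ 0 ∷ 0 ∷ 0 ∷ 0 ∷ 0 ∷ [])
  ∷ (0 ∷ 2 ∷ 0 ∷ 1 ∷ 0 ∷ 0 ∷ 1 ∷ 0 ∷ 0 ∷ 0 ∷ 2 ∷ 0 ∷ [])
  ∷ (0 ∷ 2 ∷ 0 ∷ 2 ∷ 0 ∷ 0 ∷ 0 ∷ 0 ∷ 0 ∷ 0 ∷ 0 ∷ 0 ∷ [])
  ∷ (0 ∷ 1 ∷ 2 ∷ 0 ∷ 0 ∷ 0 ∷ 1 ∷ 0 ∷ 2 ∷ 0 ∷ 0 ∷ 0 ∷ [])
  ∷ (0 ∷ 0 ∷ 0 ∷ 2 ∷ 0 ∷ 0 ∷ 2 ∷ 0 ∷ 0 ∷ 0 ∷ 0 ∷ 0 ∷ [])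
  ∷ []

link12 : Fin 12 → Fin 12 → Maybe Sign
link12 c d = code (Vec.lookup (Vec.lookup table12 c) d)
  where
  code : ℕ → Maybe Sign
  code 1 = just Sign.+
  code 2 = just Sign.-
  code _ = nothing

link12-sym : ∀ c d → link12 c d ≡ link12 d c
link12-sym = decided (FinP.all? λ c → FinP.all? λ d → MaybeP.≡-dec SignP._≟_ (link12 c d) (link12 d c))

module Sporadic12 = BlowUp link12 link12-sym

g12 : gAtMostScaled 12 72 (upper-target 12)
g12 = Sporadic12.verified (List.map (1 ,_) (allFin 12))

square-mono : ∀ {A B} → + 0 ≤ A → A ≤ B → A * A ≤ B * B
square-mono {A} {B} 0≤A A≤B = begin
  A * A ≤⟨ *-monoˡ-≤ 0≤A A≤B ⟩
  A * B ≡⟨ ℤP.*-comm A B ⟩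
  B * A ≤⟨ *-monoˡ-≤ (ℤP.≤-trans 0≤A A≤B) A≤B ⟩
  B * B ∎
  where open ℤP.≤-Reasoning

-- In the blow-up of the six-class pattern by the family below, a vertex of class c has signed
-- degree T · slope c.
slope : Fin 6 → ℤ
slope H₁ = + 1
slope H₂ = + 1
slope Z  = + 0
slope Y₁ = -[1+ 0 ]
slope Y₂ = -[1+ 0 ]
slope I  = + 0

-- Summing the blocks of the family with weights h gives T · lin h + h Z + r · h I.
lin : (Fin 6 → ℤ) → ℤ
lin h = h H₁ + h H₂ + + 2 * h Z + + 3 * h Y₁ + + 3 * h Y₂

-- Facts about the pattern itself, checked by evaluation: with w c d = weightOf (mainLink c d),
-- the weights seen from class c sum (with the family's block multiplicities) to slope c, class I
-- is invisible, and class c sees itself as it sees Z.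
pattern-slopes : ∀ c → let w = λ d → Main.weightOf (mainLink c d) in
                 lin w ≡ slope c × w I ≡ + 0 × w c ≡ w Z
pattern-slopes = decided (FinP.all? λ c → let w = λ d → Main.weightOf (mainLink c d) in
                   (lin w ℤ.≟ slope c) ×-dec (w I ℤ.≟ + 0) ×-dec (w c ℤ.≟ w Z))

-- The linking condition at slope level: for a link of sign s between classes whose slopes sum
-- to A, we need A ≥ 0 and 2A − s ≥ 1; since T ≥ 2 this gives T·A − s ≥ 1.
SlopeOK : Maybe Sign → ℤ → Set
SlopeOK nothing  A = ⊤
SlopeOK (just s) A = + 0 ≤ A × + 1 ≤ + 2 * A - val s

pattern-links : ∀ c d → SlopeOK (mainLink c d) (slope c + slope d)
pattern-links = decided (FinP.all? λ c → FinP.all? λ d → ok? (mainLink c d) (slope c + slope d))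
  where
  ok? : ∀ l A → Dec (SlopeOK l A)
  ok? nothing  A = yes tt
  ok? (just s) A = (+ 0 ℤP.≤? A) ×-dec (+ 1 ℤP.≤? + 2 * A - val s)

-- The general family, with t = u + 2: blocks of t, t, 2t + 1, 3t, 3t vertices in the classes
-- H₁, H₂, Z, Y₁, Y₂, and r isolated vertices; it has 10t + 1 + r vertices and weight −2t².
family : ℕ → ℕ → Main.Blueprint
family u r = (t , H₁) ∷ (t , H₂) ∷ (t ℕ.+ t ℕ.+ 1 , Z) ∷ (t ℕ.+ t ℕ.+ t , Y₁) ∷ (t ℕ.+ t ℕ.+ t , Y₂) ∷ (r , I) ∷ []
  where
  t : ℕ
  t = 2 ℕ.+ u

module Family (u r : ℕ) where

  τ ρ : ℤ
  τ = + (2 ℕ.+ u)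
  ρ = + r

  blockSum-family : ∀ h → Main.blockSum (family u r) h ≡ τ * lin h + h Z + ρ * h I
  blockSum-family h = shape τ ρ (h H₁) (h H₂) (h Z) (h Y₁) (h Y₂) (h I)
    where
    shape : ∀ τ ρ a b c d e f →
            τ * a + (τ * b + ((τ + τ + + 1) * c + ((τ + τ + τ) * d + ((τ + τ + τ) * e + (ρ * f + + 0)))))
            ≡ τ * (a + b + + 2 * c + + 3 * d + + 3 * e) + c + ρ * f
    shape = solve-∀

  family-σ : ∀ c → Main.σC (family u r) c ≡ τ * slope c
  family-σ c = begin
    Main.σC (family u r) c                      ≡⟨ cong (_- w c) (blockSum-family w) ⟩
    τ * lin w + w Z + ρ * w I - w c              ≡⟨ cong₂ (λ x y → τ * x + w Z + ρ * y - w c) lin≡ wI≡0 ⟩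
    τ * slope c + w Z + ρ * + 0 - w c            ≡⟨ cong (λ z → τ * slope c + w Z + ρ * + 0 - z) wc≡wZ ⟩
    τ * slope c + w Z + ρ * + 0 - w Z            ≡⟨ cancel τ (slope c) (w Z) ρ ⟩
    τ * slope c                                  ∎
    where
    open ≡-Reasoning
    w : Fin 6 → ℤ
    w d = Main.weightOf (mainLink c d)
    lin≡ : lin w ≡ slope c
    lin≡ = proj₁ (pattern-slopes c)
    wI≡0 : w I ≡ + 0
    wI≡0 = proj₁ (proj₂ (pattern-slopes c))
    wc≡wZ : w c ≡ w Z
    wc≡wZ = proj₂ (proj₂ (pattern-slopes c))
    cancel : ∀ τ A z ρ → τ * A + z + ρ * + 0 - z ≡ τ * A
    cancel = solve-∀

  family-good : Main.Good (family u r)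
  family-good c d = subst (Main.LinkOK (mainLink c d)) σ-sum (scale-up (mainLink c d) (pattern-links c d))
    where
    σ-sum : τ * (slope c + slope d) ≡ Main.σC (family u r) c + Main.σC (family u r) d
    σ-sum = trans (ℤP.*-distribˡ-+ τ (slope c) (slope d)) (≡.sym (cong₂ _+_ (family-σ c) (family-σ d)))
    scale-up : ∀ l {A} → SlopeOK l A → Main.LinkOK l (τ * A)
    scale-up nothing  _           = tt
    scale-up (just s) {A} (0≤A , 1≤2A-s) =
      ℤP.≤-trans 1≤2A-s (ℤP.+-monoˡ-≤ (- val s) (ℤP.*-monoʳ-≤-nonNeg A {{nonNegative 0≤A}} {+ 2} {τ} (+≤+ (s≤s (s≤s z≤n)))))

  family-weight : Main.blockSum (family u r) (Main.σC (family u r)) ≡ - (+ 4 * (τ * τ))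
  family-weight = begin
    Main.blockSum (family u r) (Main.σC (family u r))    ≡⟨ Main.blockSum-cong (family u r) family-σ ⟩
    Main.blockSum (family u r) (λ c → τ * slope c)       ≡⟨ Main.blockSum-scale (family u r) τ slope ⟩
    τ * Main.blockSum (family u r) slope                 ≡⟨ cong (τ *_) (blockSum-family slope) ⟩
    τ * (τ * lin slope + slope Z + ρ * slope I)          ≡⟨ evaluate τ ρ ⟩
    - (+ 4 * (τ * τ))                                    ∎
    where
    open ≡-Reasoning
    evaluate : ∀ τ ρ → τ * (τ * -[1+ 3 ] + + 0 + ρ * + 0) ≡ - (+ 4 * (τ * τ))
    evaluate = solve-∀

  N : ℕ
  N = r ℕ.+ u ℕ.* 10

  family-size : Main.size (family u r) ≡ 21 ℕ.+ N
  family-size = count u r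
    where
    count : ∀ u r → let t = 2 ℕ.+ u in
            t ℕ.+ (t ℕ.+ ((t ℕ.+ t ℕ.+ 1) ℕ.+ ((t ℕ.+ t ℕ.+ t) ℕ.+ ((t ℕ.+ t ℕ.+ t) ℕ.+ (r ℕ.+ 0)))))
            ≡ 21 ℕ.+ (r ℕ.+ u ℕ.* 10)
    count = ℕSolver.solve-∀

  -- For r ≤ 9, k − 8 = 13 + N ≤ 12t, so (k − 8)² ≤ 144 t² = −72 · weight.
  family-bound : r ℕ.≤ 9 → gAtMostScaled (21 ℕ.+ N) 72 (upper-target (21 ℕ.+ N))
  family-bound r≤9 = subst (λ k → gAtMostScaled k 72 (upper-target (21 ℕ.+ N))) family-size
    (Main.blowUp-bound (family u r) family-good σ≢0 (begin
      + 36 * Main.blockSum (family u r) (Main.σC (family u r))   ≡⟨ cong (+ 36 *_) family-weight ⟩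
      + 36 * - (+ 4 * (τ * τ))                                   ≡⟨ as-square τ ⟩
      - ((+ 12 * τ) * (+ 12 * τ))                                ≤⟨ ℤP.neg-mono-≤ (square-mono (+≤+ z≤n) (+≤+ fits)) ⟩
      upper-target (21 ℕ.+ N)                                    ∎))
    where
    open ℤP.≤-Reasoning
    as-square : ∀ τ → + 36 * - (+ 4 * (τ * τ)) ≡ - ((+ 12 * τ) * (+ 12 * τ))
    as-square = solve-∀
    fits : 13 ℕ.+ N ℕ.≤ 12 ℕ.* (2 ℕ.+ u)
    fits = ℕP.≤-trans (ℕP.+-monoʳ-≤ 13 (ℕP.+-monoˡ-≤ (u ℕ.* 10) (ℕP.≤-trans r≤9 (ℕP.m≤m+n 9 (2 ℕ.+ u ℕ.* 2)))))
                      (ℕP.≤-reflexive (regroup u))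
      where
      regroup : ∀ u → 13 ℕ.+ ((9 ℕ.+ (2 ℕ.+ u ℕ.* 2)) ℕ.+ u ℕ.* 10) ≡ 12 ℕ.* (2 ℕ.+ u)
      regroup = ℕSolver.solve-∀
    σ≢0 : Main.blockSum (family u r) (Main.σC (family u r)) ≢ + 0
    σ≢0 σ≡0 = nonzero (1 ℕ.+ u) (trans (≡.sym family-weight) σ≡0)
      where
      nonzero : ∀ n → - (+ 4 * (+ suc n * + suc n)) ≢ + 0
      nonzero n ()

large : ∀ m → gAtMostScaled (21 ℕ.+ m) 72 (upper-target (21 ℕ.+ m))
large m = subst (λ k → gAtMostScaled k 72 (upper-target k)) (cong (21 ℕ.+_) (≡.sym (m≡m%n+[m/n]*n m 10)))
                (Family.family-bound (m / 10) (m % 10) (ℕP.≤-pred (m%n<n m 10)))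

upper-bound : ∀ j → gAtMostScaled (12 ℕ.+ j) 72 (upper-target (12 ℕ.+ j))
upper-bound 0 = g12
upper-bound 1 = g13
upper-bound 2 = Main.verified (blueprint14 0)
upper-bound 3 = Main.verified (blueprint14 1)
upper-bound 4 = Main.verified (blueprint14 2)
upper-bound 5 = Main.verified (blueprint14 3)
upper-bound 6 = Main.verified (blueprint14 4)
upper-bound 7 = Main.verified (blueprint14 5)
upper-bound 8 = Main.verified (blueprint14 6)
upper-bound (suc (suc (suc (suc (suc (suc (suc (suc (suc m))))))))) = large m

lower-bound : ∀ n → gAtLeastScaled (suc n) 16 (- (+ suc n * + suc n))
lower-bound n G _ f sedf = LowerBound.lower-bound G f sedf

mainTheorem2 : (k : ℕ) → k ≥ 12 →
    gAtLeastScaled k 16 (- ((+ k) * (+ k)))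
    × gAtMostScaled k 72 (- (((+ k) - + 8) * ((+ k) - + 8)))
mainTheorem2 (suc n) k≥12 =
  lower-bound n ,
  subst (λ k → gAtMostScaled k 72 (upper-target k)) (ℕP.m+[n∸m]≡n k≥12) (upper-bound (suc n ℕ.∸ 12))
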